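{- Consider the linear program $\mathrm{LP}$ (the LP relaxation of the path-based ILP for Minimum Shortest-Path Network Design, as defined in the context) and the linear program $\mathrm{LP}^+$ obtained from $\mathrm{LP}$ by adding the subpath constraints $$z_{P[s,v]}\ \ge\ z_P \quad\text{and}\quad z_{P[v,t]}\ \ge\ z_P \qquad \forall (s,t)\in K,\ P\in\mathcal{P}_{s,t},\ v\in V(P),$$ where $P[u,w]$ denotes the subpath of $P$ from vertex $u$ to vertex $w$. Then the subpath constraints are polyhedrally strengthening, even when all arc lengths are $1$: there exists an instance $(G,\mathit{ccap},\mathit{len},p,T)$ with $\mathit{len}(a)=1$ for all arcs $a$ such that the optimal value of $\mathrm{LP}^+$ is strictly larger than the optimal value of $\mathrm{LP}$.
   Context: An instance consists of a directed graph $G=(V,A)$, arc capacities $\mathit{ccap}\colon A\to\mathbb{N}_{\ge1}$ (capacity of one connection), arc lengths $\mathit{len}\colon A\to\mathbb{N}_{\ge1}$, numbers of connections $p\colon A\to\mathbb{N}_{\ge1}$ (link $a$ consists of $p(a)$ individually deactivatable connections of capacity $\mathit{ccap}(a)$ each), and a traffic matrix $T\in\mathbb{N}^{|V|\times|V|}$. The terminal pairs are $K=\{(s,t)\in V^2: T(s,t)>0\}$. For $(s,t)\in K$, $\mathcal{P}_{s,t}$ is the set of all (simple) $s$-$t$-paths in $G$, and $|P|$ is the number of arcs of a path $P$. It is assumed that shortest paths are unique: for each $(s,t)$ the lengths induce a total order $\prec$ on $\mathcal{P}_{s,t}$ (by total length, ties broken arbitrarily), $P\prec P'$ meaning $P$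 comes before (is shorter than) $P'$. The paper also assumes that $T$ is routable along shortest paths in the full network. The linear program $\mathrm{LP}$ has variables $x_a,y_a$ for $a\in A$ and $z_P$ for $P\in\mathcal{P}_{s,t}$, $(s,t)\in K$, and reads: minimize $\sum_{a\in A}x_a$ subject to (i) $\sum_{P\in\mathcal{P}_{s,t}} z_P\ge 1$ for all $(s,t)\in K$; (ii) $\sum_{P\in\mathcal{P}_{s,t}: a\in P} z_P\le y_a$ for all $(s,t)\in K$, $a\in A$; (iii) $\sum_{(s,t)\in K}\sum_{P\in\mathcal{P}_{s,t}: a\in P} T(s,t)\, z_P\le \mathit{ccap}(a)\, x_a$ for all $a\in A$; (iv) $|P|-\sum_{a\in P} y_a\ \ge \sum_{P'\in\mathcal{P}_{s,t}: P\prec P'} z_{P'}$ for all $(s,t)\in K$, $P\in\mathcal{P}_{s,t}$; (v) $y_a\le x_a$ and $x_a\le p(a)\, y_a$ for all $a\in A$; (vi) $0\le x_a\le p(a)$, $0\le y_a\le 1$ for all $a\in A$, and $z_P\ge 0$ for all paths $P$. (This is the relaxation of the ILP in which $x_a\in\{0,\dots,p(a)\}$ is the number of active connections of $a$, $y_a\in\{0,1\}$ indicates whether $a$ is active, and $z_P\in\{0,1\}$ indicates whether $P$ is the active shortest $s$-$t$-path.)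
   Formalization: The variables $x_a,y_a$ and $z_P$ of $\mathrm{LP}$ and $\mathrm{LP}^+$ range over the rationals, so both optimal values are taken over rational solutions only. -}

module Defs where

open import Data.Nat as ℕ using (ℕ; zero; suc)
open import Data.Fin as Fin using (Fin)
open import Data.Fin.Properties using () renaming (_≟_ to _≟F_)
open import Data.Integer using (+_)
open import Data.Rational using (ℚ; 0ℚ; 1ℚ; _/_; _+_; _-_; _*_; _≤_; _<_)
open import Data.List using (List; []; _∷_; _++_; map; foldr; filter; length; allFin; concatMap)
open import Data.List.Membership.Propositional using (_∈_)
open import Data.List.Relation.Unary.Unique.Propositional using (Unique)
open import Data.List.Relation.Unary.AllPairs using (AllPairs)
open import Data.Product using (_×_; _,_)
open import Relation.Binary.PropositionalEquality using (_≡_; _≢_)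
open import Relation.Nullary using (yes; no)
import Data.List.Membership.DecPropositional as DecMem

ℕtoℚ : ℕ → ℚ
ℕtoℚ k = + k / 1

sumℚ : List ℚ → ℚ
sumℚ = foldr _+_ 0ℚ

sumℕ : List ℕ → ℕ
sumℕ = foldr ℕ._+_ 0

Path : ℕ → Set
Path m = List (Fin m)

_∈ᵃ?_ : ∀ {m} (a : Fin m) (P : Path m) → _
_∈ᵃ?_ = DecMem._∈?_ _≟F_

-- 1 if arc a lies on the first path of the list (the ≺-shortest path), else 0
onFirst : ∀ {m} → Fin m → List (Path m) → ℕ
onFirst a []      = 0
onFirst a (P ∷ _) with a ∈ᵃ? P
... | yes _ = 1
... | no  _ = 0

endvOf : ∀ {n m} → (Fin m → Fin n) → Fin n → Path m → Fin n
endvOf hd u []      = u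
endvOf hd u (a ∷ P) = endvOf hd (hd a) P

WalkOf : ∀ {n m} → (Fin m → Fin n) → (Fin m → Fin n) → Fin n → Path m → Fin n → Set
WalkOf tl hd u []      t = u ≡ t
WalkOf tl hd u (a ∷ P) t = (tl a ≡ u) × WalkOf tl hd (hd a) P t

record Instance : Set where
  field
    n m   : ℕ
    tl hd : Fin m → Fin n
    ccap len p : Fin m → ℕ
    T     : Fin n → Fin n → ℕ
    loopless   : ∀ a → tl a ≢ hd a
    noParallel : ∀ a b → tl a ≡ tl b → hd a ≡ hd b → a ≡ b
    ccap≥1 : ∀ a → 1 ℕ.≤ ccap a
    len≥1  : ∀ a → 1 ℕ.≤ len a
    p≥1    : ∀ a → 1 ℕ.≤ p a

  endv : Fin n → Path m → Fin n
  endv = endvOf hd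

  Walk : Fin n → Path m → Fin n → Set
  Walk = WalkOf tl hd

  verts : Fin n → Path m → List (Fin n)
  verts s P = s ∷ map hd P

  SimplePath : Fin n → Fin n → Path m → Set
  SimplePath s t P = Walk s P t × Unique (verts s P)

  pathLen : Path m → ℕ
  pathLen P = sumℕ (map len P)

  InK : Fin n → Fin n → Set
  InK s t = 0 ℕ.< T s t

  vertices : List (Fin n)
  vertices = allFin n

  field
    -- 𝒫_{s,t} listed in the order ≺: every simple s-t-path occurs exactly
    -- once, the list is sorted by total length, ties broken arbitrarily
    -- (namely by the position in the list).
    paths         : Fin n → Fin n → List (Path m)
    paths-simple  : ∀ s t P → P ∈ paths s t → SimplePath s t P
    paths-all     : ∀ s t P → SimplePath s t P → P ∈ paths s t
    paths-unique  : ∀ s t → Unique (paths s t)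
    paths-sorted  : ∀ s t → AllPairs (λ P Q → pathLen P ℕ.≤ pathLen Q) (paths s t)
    -- standing assumption: T is routable along the (unique) shortest
    -- paths of the full network
    routable : ∀ a →
      sumℕ (concatMap (λ s → map (λ t → T s t ℕ.* onFirst a (paths s t)) vertices) vertices)
        ℕ.≤ ccap a ℕ.* p a


UnitLengths : Instance → Set
UnitLengths I = ∀ a → Instance.len I a ≡ 1

-- Candidate (rational) solutions of LP / LP⁺.
-- z s t P is the variable z_P for P ∈ 𝒫_{s,t}; only its values on the
-- paths in `paths s t` for (s,t) ∈ K enter the program.

record Solution (I : Instance) : Set where
  field
    x y : Fin (Instance.m I) → ℚ
    z   : Fin (Instance.n I) → Fin (Instance.n I) → Path (Instance.m I) → ℚ

module _ (I : Instance) (S : Solution I) where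
  open Instance I
  open Solution S

  flowOn : Fin m → Fin n → Fin n → ℚ
  flowOn a s t = sumℚ (map (z s t) (filter (a ∈ᵃ?_) (paths s t)))

  objective : ℚ
  objective = sumℚ (map x (allFin m))

  record FeasibleLP : Set where
    field
      c-i   : ∀ s t → InK s t → 1ℚ ≤ sumℚ (map (z s t) (paths s t))
      c-ii  : ∀ s t → InK s t → ∀ a → flowOn a s t ≤ y a
      -- (iii)   (pairs outside K have T(s,t) = 0 and contribute 0)
      c-iii : ∀ a →
        sumℚ (concatMap (λ s → map (λ t → ℕtoℚ (T s t) * flowOn a s t) vertices) vertices)
          ≤ ℕtoℚ (ccap a) * x a
      -- (iv)  for P with 𝒫_{s,t} = L₁ ++ P ∷ L₂, the ≺-later paths are L₂
      c-iv  : ∀ s t → InK s t → ∀ L₁ P L₂ → paths s t ≡ L₁ ++ P ∷ L₂ →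
        sumℚ (map (z s t) L₂) ≤ ℕtoℚ (length P) - sumℚ (map y P)
      c-v₁  : ∀ a → y a ≤ x a
      c-v₂  : ∀ a → x a ≤ ℕtoℚ (p a) * y a
      c-x₀  : ∀ a → 0ℚ ≤ x a
      c-x₁  : ∀ a → x a ≤ ℕtoℚ (p a)
      c-y₀  : ∀ a → 0ℚ ≤ y a
      c-y₁  : ∀ a → y a ≤ 1ℚ
      c-z   : ∀ s t → InK s t → ∀ P → P ∈ paths s t → 0ℚ ≤ z s t P

  -- subpath constraints: for P ∈ 𝒫_{s,t} and v ∈ V(P), written P = Q ++ R
  -- with Q = P[s,v], R = P[v,t], v = endv s Q.  A constraint is imposed
  -- whenever the corresponding variable exists, i.e. the pair is in K.
  record SubpathConstraints : Set where
    field
      c-pre : ∀ s t → InK s t → ∀ P → P ∈ paths s t → ∀ Q R → P ≡ Q ++ R →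
        InK s (endv s Q) → z s t P ≤ z s (endv s Q) Q
      c-suf : ∀ s t → InK s t → ∀ P → P ∈ paths s t → ∀ Q R → P ≡ Q ++ R →
        InK (endv s Q) t → z s t P ≤ z (endv s Q) t R

  FeasibleLP⁺ : Set
  FeasibleLP⁺ = FeasibleLP × SubpathConstraints

{-# OPTIONS --safe #-}
-- Take the unit-length network s→t, s→v, v→t, v→w, t→w with demands 3 from s to t and
-- 2 from s to w. LP admits a fractional point of value 58/15 that sends 2/5 of the s-w
-- demand along s·v·t·w but only 1/5 of the s-t demand along its prefix s·v·t: constraint
-- (iv) couples only paths of the same terminal pair. With the subpath constraints, a
-- nonnegative combination of twelve constraints (a dual solution) shows that every LP⁺
-- point costs at least 59/15. The programs are finite, so feasibility of explicit points
-- is decided by evaluation.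
module Submission where

open import Defs
open import Data.Rational using (_<_)
open import Data.Product using (Σ; _×_)

open import Level using (Level; 0ℓ)
open import Function using (_∘_)
open import Data.Empty using (⊥-elim)
open import Data.Product using (_,_)
open import Data.Nat as ℕ using (ℕ; zero; suc; z≤n; s≤s; s≤s⁻¹; z<s)
open import Data.Fin using (Fin; zero; suc)
open import Data.Fin.Patterns
open import Data.Fin.Properties using (all?; injective⇒≤) renaming (_≟_ to _≟ᶠ_)
open import Data.Integer using (+_)
open import Data.Rational as ℚ using (ℚ; 0ℚ; 1ℚ; _+_; _*_; _-_; _/_; _≤_; NonNegative)
import Data.Rational.Properties as ℚ
import Data.Nat.Properties as ℕ
open import Data.List using (List; []; _∷_; _++_; map; foldr; filter; length; lookup; concatMap; allFin)
open import Data.List.Properties using (∷-injective; ∷-injectiveʳ; foldr-++; length-map; filter-accept; filter-reject; ≡-dec)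
open import Data.List.Membership.Propositional using (_∈_)
open import Data.List.Membership.Propositional.Properties using (∈-lookup)
import Data.List.Membership.DecPropositional as DecMembership
import Data.List.Relation.Unary.All as All
open import Data.List.Relation.Unary.Any using (here; there)
open import Data.List.Relation.Unary.AllPairs using (_∷_; allPairs?)
open import Data.List.Relation.Unary.Unique.Propositional using (Unique)
open import Data.List.Relation.Unary.Unique.DecPropositional using (unique?)
open import Relation.Nullary using (Dec; yes; no; ¬?)
open import Relation.Nullary.Decidable using (map′; _×-dec_; _→-dec_; from-yes; dec⇒maybe)
open import Relation.Binary.PropositionalEquality using (_≡_; refl; sym; trans; cong; subst)
open import Tactic.RingSolver using (solve-∀)
import Tactic.RingSolver.Core.AlmostCommutativeRing as ACR

private
  variable
    a ℓ : Level
    A : Set a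

∀-++? : {R : List A → List A → Set ℓ} → (∀ ys zs → Dec (R ys zs)) →
        ∀ xs → Dec (∀ ys zs → xs ≡ ys ++ zs → R ys zs)
∀-++? {R = R} R? [] = map′ split-[] (λ f → f [] [] refl) (R? [] [])
  where
  split-[] : R [] [] → ∀ ys zs → [] ≡ ys ++ zs → R ys zs
  split-[] r [] [] refl = r
  split-[] r [] (_ ∷ _) ()
  split-[] r (_ ∷ _) _ ()
∀-++? {R = R} R? (x ∷ xs) = map′ split-∷ unsplit-∷ (R? [] (x ∷ xs) ×-dec ∀-++? (R? ∘ (x ∷_)) xs)
  where
  split-∷ : R [] (x ∷ xs) × (∀ ys zs → xs ≡ ys ++ zs → R (x ∷ ys) zs) →
            ∀ ys zs → x ∷ xs ≡ ys ++ zs → R ys zs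
  split-∷ (r , _) []       _  refl = r
  split-∷ (_ , f) (_ ∷ ys) zs eq   with refl , eq′ ← ∷-injective eq = f ys zs eq′
  unsplit-∷ : (∀ ys zs → x ∷ xs ≡ ys ++ zs → R ys zs) →
              R [] (x ∷ xs) × (∀ ys zs → xs ≡ ys ++ zs → R (x ∷ ys) zs)
  unsplit-∷ f = f [] (x ∷ xs) refl , λ ys zs eq → f (x ∷ ys) zs (cong (x ∷_) eq)

∀-++-∷? : {R : A → List A → Set ℓ} → (∀ y zs → Dec (R y zs)) →
          ∀ xs → Dec (∀ ys y zs → xs ≡ ys ++ y ∷ zs → R y zs)
∀-++-∷? R? []       = yes λ { [] _ _ () ; (_ ∷ _) _ _ () }
∀-++-∷? {R = R} R? (x ∷ xs) = map′ split-∷ unsplit-∷ (R? x xs ×-dec ∀-++-∷? R? xs)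
  where
  split-∷ : R x xs × (∀ ys y zs → xs ≡ ys ++ y ∷ zs → R y zs) →
            ∀ ys y zs → x ∷ xs ≡ ys ++ y ∷ zs → R y zs
  split-∷ (r , _) []       _ _  refl = r
  split-∷ (_ , f) (_ ∷ ys) y zs eq   = f ys y zs (∷-injectiveʳ eq)
  unsplit-∷ : (∀ ys y zs → x ∷ xs ≡ ys ++ y ∷ zs → R y zs) →
              R x xs × (∀ ys y zs → xs ≡ ys ++ y ∷ zs → R y zs)
  unsplit-∷ f = f [] x xs refl , λ ys y zs eq → f (x ∷ ys) y zs (cong (x ∷_) eq)

∀-∈? : {P : A → Set ℓ} → (∀ x → Dec (P x)) → ∀ xs → Dec (∀ x → x ∈ xs → P x)
∀-∈? P? xs = map′ (λ ps _ → All.lookup ps) (λ f → All.tabulate (f _)) (All.all? P? xs)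

unique⇒lookup-injective : {xs : List A} → Unique xs → ∀ {i j} → lookup xs i ≡ lookup xs j → i ≡ j
unique⇒lookup-injective (_  ∷ _) {zero}  {zero}  _  = refl
unique⇒lookup-injective (x∉ ∷ _) {zero}  {suc j} eq = ⊥-elim (All.lookup x∉ (∈-lookup j) eq)
unique⇒lookup-injective (x∉ ∷ _) {suc i} {zero}  eq = ⊥-elim (All.lookup x∉ (∈-lookup i) (sym eq))
unique⇒lookup-injective (_  ∷ u) {suc i} {suc j} eq = cong suc (unique⇒lookup-injective u eq)

∀-length≤? : ∀ {m} {P : List (Fin m) → Set ℓ} k → (∀ xs → Dec (P xs)) →
             Dec (∀ xs → length xs ℕ.≤ k → P xs)
∀-length≤? zero    P? = map′ (λ p → λ { [] _ → p ; (_ ∷ _) () }) (λ f → f [] z≤n) (P? [])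
∀-length≤? {P = P} (suc k) P? =
  map′ split-∷ unsplit-∷ (P? [] ×-dec all? λ x → ∀-length≤? k (P? ∘ (x ∷_)))
  where
  split-∷ : P [] × (∀ x xs → length xs ℕ.≤ k → P (x ∷ xs)) →
            ∀ xs → length xs ℕ.≤ suc k → P xs
  split-∷ (p , _) []       _       = p
  split-∷ (_ , f) (x ∷ xs) (s≤s l) = f x xs l
  unsplit-∷ : (∀ xs → length xs ℕ.≤ suc k → P xs) →
              P [] × (∀ x xs → length xs ℕ.≤ k → P (x ∷ xs))
  unsplit-∷ f = f [] z≤n , λ x xs l → f (x ∷ xs) (s≤s l)

unique⇒length≤ : ∀ {n} {xs : List (Fin n)} → Unique xs → length xs ℕ.≤ n
unique⇒length≤ {xs = xs} u = injective⇒≤ {f = lookup xs} (unique⇒lookup-injective u)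

foldr-+-dropZeroWeights : (c : A → ℕ) (g : A → ℚ) (b : ℚ) (xs : List A) →
  foldr _+_ b (map (λ x → ℕtoℚ (c x) * g x) xs) ≡
  foldr _+_ b (map (λ x → ℕtoℚ (c x) * g x) (filter (λ x → 0 ℕ.<? c x) xs))
foldr-+-dropZeroWeights c g b []       = refl
foldr-+-dropZeroWeights {A = A} c g b (x ∷ xs) = step (positive? x)
  where
  w : A → ℚ
  w x = ℕtoℚ (c x) * g x
  positive? : ∀ x → Dec (0 ℕ.< c x)
  positive? x = 0 ℕ.<? c x
  sum-over : List A → ℚ
  sum-over ys = foldr _+_ b (map w ys)
  ih : sum-over xs ≡ sum-over (filter positive? xs)
  ih = foldr-+-dropZeroWeights c g b xs
  step : Dec (0 ℕ.< c x) → sum-over (x ∷ xs) ≡ sum-over (filter positive? (x ∷ xs))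
  step (yes c>0) =
    trans (cong (λ q → w x + q) ih) (cong sum-over (sym (filter-accept positive? c>0)))
  step (no  c≯0) =
    trans (cong (_+ _) zero-weight)
    (trans (ℚ.+-identityˡ _) (trans ih (cong sum-over (sym (filter-reject positive? c≯0)))))
    where
    zero-weight : w x ≡ 0ℚ
    zero-weight = trans (cong (λ k → ℕtoℚ k * g x) (ℕ.n≤0⇒n≡0 (ℕ.≮⇒≥ c≯0))) (ℚ.*-zeroˡ (g x))

sum-dropZeroWeights : ∀ {b} {B : Set b} (T : A → B → ℕ) (g : A → B → ℚ)
                      (us : List A) (vs : List B) →
  sumℚ (concatMap (λ u → map (λ v → ℕtoℚ (T u v) * g u v) vs) us) ≡
  sumℚ (concatMap (λ u → map (λ v → ℕtoℚ (T u v) * g u v) (filter (λ v → 0 ℕ.<? T u v) vs)) us)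
sum-dropZeroWeights T g []       vs = refl
sum-dropZeroWeights {B = B} T g (u ∷ us) vs =
  trans (foldr-++ _+_ 0ℚ (row vs) _)
  (trans (cong (λ b → foldr _+_ b (row vs)) (sum-dropZeroWeights T g us vs))
  (trans (foldr-+-dropZeroWeights (T u) (g u) _ vs)
         (sym (foldr-++ _+_ 0ℚ (row (filter (λ v → 0 ℕ.<? T u v) vs)) _))))
  where
  row : List B → List ℚ
  row ws = map (λ v → ℕtoℚ (T u v) * g u v) ws

scaled-slack-nonNeg : ∀ c .{{_ : NonNegative c}} {l r} → l ≤ r → 0ℚ ≤ c * (r - l)
scaled-slack-nonNeg c {l} {r} l≤r =
  subst (_≤ c * (r - l)) (ℚ.*-zeroʳ c)
    (ℚ.*-monoˡ-≤-nonNeg c (subst (_≤ r - l) (ℚ.+-inverseʳ l) (ℚ.+-monoˡ-≤ (ℚ.- l) l≤r)))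

ℚ-ring : ACR.AlmostCommutativeRing 0ℓ 0ℓ
ℚ-ring = ACR.fromCommutativeRing ℚ.+-*-commutativeRing (λ q → dec⇒maybe (0ℚ ℚ.≟ q))

module _ {n m} (tl hd : Fin m → Fin n) where

  walk? : ∀ u P t → Dec (WalkOf tl hd u P t)
  walk? u []      t = u ≟ᶠ t
  walk? u (a ∷ P) t = (tl a ≟ᶠ u) ×-dec walk? (hd a) P t

  simplePath? : ∀ s t P → Dec (WalkOf tl hd s P t × Unique (s ∷ map hd P))
  simplePath? s t P = walk? s P t ×-dec unique? _≟ᶠ_ (s ∷ map hd P)

  simplePath-length< : ∀ s P → Unique (s ∷ map hd P) → length P ℕ.< n
  simplePath-length< s P u = subst (ℕ._< n) (length-map hd P) (unique⇒length≤ u)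

module _ (I : Instance) (S : Solution I) where
  open Instance I
  open Solution S

  private
    inK? : ∀ s t → Dec (InK s t)
    inK? s t = 0 ℕ.<? T s t

  feasibleLP? : Dec (FeasibleLP I S)
  feasibleLP? = map′
    (λ (i , ii , iii , iv , v₁ , v₂ , x₀ , x₁ , y₀ , y₁ , z₀) → record
      { c-i = i ; c-ii = ii ; c-iii = iii ; c-iv = iv ; c-v₁ = v₁ ; c-v₂ = v₂
      ; c-x₀ = x₀ ; c-x₁ = x₁ ; c-y₀ = y₀ ; c-y₁ = y₁ ; c-z = z₀ })
    (λ F → let open FeasibleLP F in
      c-i , c-ii , c-iii , c-iv , c-v₁ , c-v₂ , c-x₀ , c-x₁ , c-y₀ , c-y₁ , c-z)
    (    (all? λ s → all? λ t → inK? s t →-dec 1ℚ ℚ.≤? sumℚ (map (z s t) (paths s t)))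
    ×-dec (all? λ s → all? λ t → inK? s t →-dec all? λ a → flowOn I S a s t ℚ.≤? y a)
    ×-dec (all? λ a →
             sumℚ (concatMap (λ s → map (λ t → ℕtoℚ (T s t) * flowOn I S a s t) vertices) vertices)
               ℚ.≤? ℕtoℚ (ccap a) * x a)
    ×-dec (all? λ s → all? λ t → inK? s t →-dec
             ∀-++-∷? (λ P L → sumℚ (map (z s t) L) ℚ.≤? ℕtoℚ (length P) - sumℚ (map y P)) (paths s t))
    ×-dec (all? λ a → y a ℚ.≤? x a)
    ×-dec (all? λ a → x a ℚ.≤? ℕtoℚ (p a) * y a)
    ×-dec (all? λ a → 0ℚ ℚ.≤? x a)
    ×-dec (all? λ a → x a ℚ.≤? ℕtoℚ (p a))
    ×-dec (all? λ a → 0ℚ ℚ.≤? y a)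
    ×-dec (all? λ a → y a ℚ.≤? 1ℚ)
    ×-dec (all? λ s → all? λ t → inK? s t →-dec ∀-∈? (λ P → 0ℚ ℚ.≤? z s t P) (paths s t)))

  subpathConstraints? : Dec (SubpathConstraints I S)
  subpathConstraints? = map′
    (λ (pre , suf) → record { c-pre = pre ; c-suf = suf })
    (λ C → SubpathConstraints.c-pre C , SubpathConstraints.c-suf C)
    (    (all? λ s → all? λ t → inK? s t →-dec ∀-∈? (λ P → ∀-++? (λ Q R →
             inK? s (endv s Q) →-dec z s t P ℚ.≤? z s (endv s Q) Q) P) (paths s t))
    ×-dec (all? λ s → all? λ t → inK? s t →-dec ∀-∈? (λ P → ∀-++? (λ Q R →
             inK? (endv s Q) t →-dec z s t P ℚ.≤? z (endv s Q) t R) P) (paths s t)))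

-- The network has vertices s, v, t, w (namely 0F, 1F, 2F, 3F); arc xy runs from x to y.
pattern st = 0F
pattern sv = 1F
pattern vt = 2F
pattern vw = 3F
pattern tw = 4F

tailOf headOf : Fin 5 → Fin 4
tailOf st = 0F
tailOf sv = 0F
tailOf vt = 1F
tailOf vw = 1F
tailOf tw = 2F
headOf st = 2F
headOf sv = 1F
headOf vt = 2F
headOf vw = 3F
headOf tw = 3F

capacity : Fin 5 → ℕ
capacity st = 2
capacity sv = 3
capacity vt = 3
capacity vw = 1
capacity tw = 2

demand : Fin 4 → Fin 4 → ℕ
demand 0F 2F = 3
demand 0F 3F = 2
demand _  _  = 0

pathsByLength : Fin 4 → Fin 4 → List (Path 5)
pathsByLength 0F 0F = [] ∷ []
pathsByLength 1F 1F = [] ∷ []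
pathsByLength 2F 2F = [] ∷ []
pathsByLength 3F 3F = [] ∷ []
pathsByLength 0F 1F = (sv ∷ []) ∷ []
pathsByLength 0F 2F = (st ∷ []) ∷ (sv ∷ vt ∷ []) ∷ []
pathsByLength 0F 3F = (sv ∷ vw ∷ []) ∷ (st ∷ tw ∷ []) ∷ (sv ∷ vt ∷ tw ∷ []) ∷ []
pathsByLength 1F 2F = (vt ∷ []) ∷ []
pathsByLength 1F 3F = (vw ∷ []) ∷ (vt ∷ tw ∷ []) ∷ []
pathsByLength 2F 3F = (tw ∷ []) ∷ []
pathsByLength _  _  = []

_∈?_ : (P : Path 5) (Ps : List (Path 5)) → Dec (P ∈ Ps)
_∈?_ = DecMembership._∈?_ (≡-dec _≟ᶠ_)

pathsByLength-complete : ∀ s t P → WalkOf tailOf headOf s P t × Unique (s ∷ map headOf P) →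
                         P ∈ pathsByLength s t
pathsByLength-complete s t P simple@(_ , distinct) =
  from-yes (all? λ s → all? λ t → ∀-length≤? 3 λ P →
              simplePath? tailOf headOf s t P →-dec P ∈? pathsByLength s t)
    s t P (s≤s⁻¹ (simplePath-length< tailOf headOf s P distinct)) simple

network : Instance
network = record
  { n = 4 ; m = 5 ; tl = tailOf ; hd = headOf
  ; ccap = capacity ; len = λ _ → 1 ; p = λ _ → 2 ; T = demand
  ; loopless   = from-yes (all? λ a → ¬? (tailOf a ≟ᶠ headOf a))
  ; noParallel = from-yes (all? λ a → all? λ b →
                   tailOf a ≟ᶠ tailOf b →-dec headOf a ≟ᶠ headOf b →-dec a ≟ᶠ b)
  ; ccap≥1 = from-yes (all? λ a → 1 ℕ.≤? capacity a)
  ; len≥1  = λ _ → s≤s z≤n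
  ; p≥1    = λ _ → s≤s z≤n
  ; paths        = pathsByLength
  ; paths-simple = from-yes (all? λ s → all? λ t →
                     ∀-∈? (simplePath? tailOf headOf s t) (pathsByLength s t))
  ; paths-all    = pathsByLength-complete
  ; paths-unique = from-yes (all? λ s → all? λ t → unique? (≡-dec _≟ᶠ_) (pathsByLength s t))
  ; paths-sorted = from-yes (all? λ s → all? λ t →
                     allPairs? (λ P Q → sumℕ (map (λ _ → 1) P) ℕ.≤? sumℕ (map (λ _ → 1) Q))
                               (pathsByLength s t))
  ; routable = from-yes (all? λ a →
      sumℕ (concatMap (λ s → map (λ t → demand s t ℕ.* onFirst a (pathsByLength s t)) (allFin 4))
                      (allFin 4))
        ℕ.≤? capacity a ℕ.* 2)
  }

unit-lengths : UnitLengths network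
unit-lengths _ = refl

lp-solution : Solution network
lp-solution = record { x = x ; y = y ; z = λ _ _ → z }
  where
  x y : Fin 5 → ℚ
  x st = + 8 / 5
  x sv = + 3 / 5
  x vt = + 7 / 15
  x vw = + 2 / 5
  x tw = + 4 / 5
  y st = + 4 / 5
  y sv = + 3 / 5
  y vt = + 2 / 5
  y vw = + 2 / 5
  y tw = + 4 / 5
  z : Path 5 → ℚ
  z (st ∷ [])           = + 4 / 5
  z (sv ∷ vt ∷ [])      = + 1 / 5
  z (sv ∷ vw ∷ [])      = + 1 / 5
  z (st ∷ tw ∷ [])      = + 2 / 5
  z (sv ∷ vt ∷ tw ∷ []) = + 2 / 5
  z _                   = 0ℚ

lp⁺-solution : Solution network
lp⁺-solution = record { x = x ; y = y ; z = λ _ _ → z }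
  where
  x y : Fin 5 → ℚ
  x st = + 8 / 5
  x sv = + 3 / 5
  x vt = + 1 / 3
  x vw = + 4 / 5
  x tw = + 3 / 5
  y st = + 4 / 5
  y sv = + 3 / 5
  y vt = + 1 / 5
  y vw = + 4 / 5
  y tw = + 3 / 5
  z : Path 5 → ℚ
  z (st ∷ [])           = + 4 / 5
  z (sv ∷ vt ∷ [])      = + 1 / 5
  z (sv ∷ vw ∷ [])      = + 2 / 5
  z (st ∷ tw ∷ [])      = + 2 / 5
  z (sv ∷ vt ∷ tw ∷ []) = + 1 / 5
  z _                   = 0ℚ

lp-objective<59/15 : objective network lp-solution < + 59 / 15
lp-objective<59/15 = from-yes (objective network lp-solution ℚ.<? + 59 / 15)

-- Each bracket is the slack of an LP⁺ constraint, written exactly as that constraint unfolds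
-- (p and q are the z-values of the s-t and s-w paths); the weights form a dual solution.
lp⁺-certificate : ∀ xst xsv xvt xvw xtw yst ysv p₁ p₂ q₁ q₂ q₃ →
  xst + (xsv + (xvt + (xvw + (xtw + 0ℚ)))) ≡
  + 59 / 15 +
  ( + 14 / 5  * (p₁ + (p₂ + 0ℚ) - 1ℚ)
  + (+ 26 / 15 * (ℕtoℚ 1 - (yst + 0ℚ) - (p₂ + 0ℚ))
  + (+ 43 / 15 * (q₁ + (q₂ + (q₃ + 0ℚ)) - 1ℚ)
  + (+ 3 / 5   * (ysv - (q₁ + (q₃ + 0ℚ)))
  + (+ 1 / 2   * (ℕtoℚ 2 * xtw - (ℕtoℚ 3 * 0ℚ + (ℕtoℚ 2 * (q₂ + (q₃ + 0ℚ)) + 0ℚ)))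
  + (+ 2 / 15  * (ℕtoℚ 3 * xsv - (ℕtoℚ 3 * (p₂ + 0ℚ) + (ℕtoℚ 2 * (q₁ + (q₃ + 0ℚ)) + 0ℚ)))
  + (+ 3 / 5   * (xsv - ysv)
  + (1ℚ        * (ℕtoℚ 1 * xvw - (ℕtoℚ 3 * 0ℚ + (ℕtoℚ 2 * (q₁ + 0ℚ) + 0ℚ)))
  + (+ 14 / 15 * (ℕtoℚ 2 * xst - (ℕtoℚ 3 * (p₁ + 0ℚ) + (ℕtoℚ 2 * (q₂ + 0ℚ) + 0ℚ)))
  + (+ 13 / 15 * (ℕtoℚ 2 * yst - xst)
  + (+ 1 / 3   * (ℕtoℚ 3 * xvt - (ℕtoℚ 3 * (p₂ + 0ℚ) + (ℕtoℚ 2 * (q₃ + 0ℚ) + 0ℚ)))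
  +  + 1 / 3   * (p₂ - q₃))))))))))))
lp⁺-certificate = solve-∀ ℚ-ring

lp⁺-objective≥59/15 : (S : Solution network) → FeasibleLP⁺ network S →
                      + 59 / 15 ≤ objective network S
lp⁺-objective≥59/15 S (F , C) =
  subst (+ 59 / 15 ≤_)
    (sym (lp⁺-certificate (x st) (x sv) (x vt) (x vw) (x tw) (y st) (y sv) p₁ p₂ q₁ q₂ q₃))
    (ℚ.+-monoʳ-≤ (+ 59 / 15)
      ( scaled-slack-nonNeg (+ 14 / 5)  (c-i 0F 2F z<s)
      ⊕ scaled-slack-nonNeg (+ 26 / 15) (c-iv 0F 2F z<s [] (st ∷ []) ((sv ∷ vt ∷ []) ∷ []) refl)
      ⊕ scaled-slack-nonNeg (+ 43 / 15) (c-i 0F 3F z<s)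
      ⊕ scaled-slack-nonNeg (+ 3 / 5)   (c-ii 0F 3F z<s sv)
      ⊕ scaled-slack-nonNeg (+ 1 / 2)   (capacity-bound tw)
      ⊕ scaled-slack-nonNeg (+ 2 / 15)  (capacity-bound sv)
      ⊕ scaled-slack-nonNeg (+ 3 / 5)   (c-v₁ sv)
      ⊕ scaled-slack-nonNeg 1ℚ          (capacity-bound vw)
      ⊕ scaled-slack-nonNeg (+ 14 / 15) (capacity-bound st)
      ⊕ scaled-slack-nonNeg (+ 13 / 15) (c-v₂ st)
      ⊕ scaled-slack-nonNeg (+ 1 / 3)   (capacity-bound vt)
      ⊕ scaled-slack-nonNeg (+ 1 / 3)   (SubpathConstraints.c-pre C 0F 3F z<s (sv ∷ vt ∷ tw ∷ [])
                                           (there (there (here refl))) (sv ∷ vt ∷ []) (tw ∷ []) refl z<s)))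
  where
  open Solution S
  open FeasibleLP F

  p₁ p₂ q₁ q₂ q₃ : ℚ
  p₁ = z 0F 2F (st ∷ [])
  p₂ = z 0F 2F (sv ∷ vt ∷ [])
  q₁ = z 0F 3F (sv ∷ vw ∷ [])
  q₂ = z 0F 3F (st ∷ tw ∷ [])
  q₃ = z 0F 3F (sv ∷ vt ∷ tw ∷ [])

  capacity-bound : ∀ a →
    sumℚ (concatMap (λ s → map (λ t → ℕtoℚ (demand s t) * flowOn network S a s t)
                                (filter (λ t → 0 ℕ.<? demand s t) (allFin 4))) (allFin 4))
      ≤ ℕtoℚ (capacity a) * x a
  capacity-bound a =
    subst (_≤ ℕtoℚ (capacity a) * x a)
      (sum-dropZeroWeights demand (flowOn network S a) (allFin 4) (allFin 4)) (c-iii a)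

  infixr 5 _⊕_
  _⊕_ : ∀ {q r} → 0ℚ ≤ q → 0ℚ ≤ r → 0ℚ ≤ q + r
  _⊕_ = ℚ.+-mono-≤

theorem1 : Σ Instance (λ I → UnitLengths I ×
             Σ (Solution I) (λ S → FeasibleLP I S ×
               (Σ (Solution I) (λ S′ → FeasibleLP⁺ I S′) ×
                ((S′ : Solution I) → FeasibleLP⁺ I S′ → objective I S < objective I S′))))
theorem1 =
  network , unit-lengths ,
  lp-solution , from-yes (feasibleLP? network lp-solution) ,
  (lp⁺-solution , from-yes (feasibleLP? network lp⁺-solution)
                 , from-yes (subpathConstraints? network lp⁺-solution)) ,
  λ S F → ℚ.<-≤-trans lp-objective<59/15 (lp⁺-objective≥59/15 S F)
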